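{- Let $(Q,+,\cdot,\le)$ be an ordered field and $n\ge 2$, and assume $n=2$ or that $(Q,+,\cdot,\le)$ is a Euclidean field. Let $\rho$ be any of the relations $\tau,\lambda,\sigma$. Then every nonempty binary relation on $Q^n$ that is first-order definable in $(Q^n,\rho)$ is the union of some of the relations $\tau$, $\sigma$, $\lambda$ and $=$.
   Context: For $p=(p_0,\dots,p_{n-1}),\,q=(q_0,\dots,q_{n-1})\in Q^n$: $p\,\tau\,q$ iff $(p_0-q_0)^2>\sum_{i=1}^{n-1}(p_i-q_i)^2$; $p\,\lambda\,q$ iff $(p_0-q_0)^2=\sum_{i=1}^{n-1}(p_i-q_i)^2$ and $p_0\neq q_0$; $p\,\sigma\,q$ iff $(p_0-q_0)^2<\sum_{i=1}^{n-1}(p_i-q_i)^2$. An ordered field is Euclidean if every nonnegative element is a square. "Definable in $(Q^n,\rho)$" means definable by a first-order formula (with equality, without parameters) in the language with one binary relation symbol interpreted as $\rho$. -}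

module Defs where

open import Level using (Level; _⊔_) renaming (suc to lsuc)
open import Data.Nat using (ℕ; zero; suc)
open import Data.Fin using (Fin)
open import Data.Vec using (Vec; []; _∷_; head; tail)
open import Data.Bool using (Bool; true)
open import Data.Product using (Σ; ∃; ∃-syntax; _×_; _,_)
open import Data.Empty using (⊥)
open import Data.Sum using (_⊎_)
open import Relation.Nullary using (¬_)
open import Relation.Binary.PropositionalEquality using (_≡_)
open import Relation.Binary using (Rel; IsTotalOrder)
open import Algebra.Core using (Op₁; Op₂)
open import Algebra.Structures using (IsCommutativeRing)
open import Function.Bundles using (_⇔_)

record OrderedField (c ℓ : Level) : Set (lsuc (c ⊔ ℓ)) where
  infixl 7 _*_
  infixl 6 _+_
  infix 4 _≤_
  field
    Carrier : Set c
    _+_ _*_ : Op₂ Carrier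
    -_      : Op₁ Carrier
    0# 1#   : Carrier
    isCommutativeRing : IsCommutativeRing _≡_ _+_ _*_ -_ 0# 1#
    0≢1     : ¬ (0# ≡ 1#)
    inverse : ∀ x → ¬ (x ≡ 0#) → ∃[ y ] (x * y ≡ 1#)
    _≤_     : Rel Carrier ℓ
    isTotalOrder : IsTotalOrder _≡_ _≤_
    +-mono-≤ : ∀ {x y} z → x ≤ y → x + z ≤ y + z
    *-nonneg : ∀ {x y} → 0# ≤ x → 0# ≤ y → 0# ≤ x * y

  _<_ : Rel Carrier (c ⊔ ℓ)
  x < y = x ≤ y × ¬ (x ≡ y)

  _-_ : Op₂ Carrier
  x - y = x + (- y)

  sq : Carrier → Carrier
  sq x = x * x

IsEuclidean : ∀ {c ℓ} → OrderedField c ℓ → Set (c ⊔ ℓ)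
IsEuclidean F = ∀ x → 0# ≤ x → ∃[ y ] (y * y ≡ x)
  where open OrderedField F

-- The space Q^n, with n = suc m; coordinate 0 is the head of the vector.

module Space {c ℓ} (F : OrderedField c ℓ) where
  open OrderedField F

  Point : ℕ → Set c
  Point n = Vec Carrier n

  sumSqDiff : ∀ {k} → Vec Carrier k → Vec Carrier k → Carrier
  sumSqDiff []       []       = 0#
  sumSqDiff (x ∷ xs) (y ∷ ys) = sq (x - y) + sumSqDiff xs ys

  timeSq : ∀ {m} → Point (suc m) → Point (suc m) → Carrier
  timeSq p q = sq (head p - head q)

  spaceSq : ∀ {m} → Point (suc m) → Point (suc m) → Carrier
  spaceSq p q = sumSqDiff (tail p) (tail q)

  τ-rel : ∀ {m} → Rel (Point (suc m)) (c ⊔ ℓ)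
  τ-rel p q = spaceSq p q < timeSq p q

  λ-rel : ∀ {m} → Rel (Point (suc m)) c
  λ-rel p q = (timeSq p q ≡ spaceSq p q) × ¬ (head p ≡ head q)

  σ-rel : ∀ {m} → Rel (Point (suc m)) (c ⊔ ℓ)
  σ-rel p q = timeSq p q < spaceSq p q

-- First-order logic with equality in a language with one binary
-- relation symbol; formulas with k free variables (de Bruijn), no
-- parameters.

data Formula : ℕ → Set where
  rel  : ∀ {k} → Fin k → Fin k → Formula k
  eq   : ∀ {k} → Fin k → Fin k → Formula k
  falsum : ∀ {k} → Formula k
  neg  : ∀ {k} → Formula k → Formula k
  and  : ∀ {k} → Formula k → Formula k → Formula k
  or   : ∀ {k} → Formula k → Formula k → Formula k
  imp  : ∀ {k} → Formula k → Formula k → Formula k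
  all  : ∀ {k} → Formula (suc k) → Formula k
  ex   : ∀ {k} → Formula (suc k) → Formula k

extend : ∀ {a} {M : Set a} {k} → M → (Fin k → M) → Fin (suc k) → M
extend x env Fin.zero    = x
extend x env (Fin.suc i) = env i

Sat : ∀ {a b} {M : Set a} (R : Rel M b) {k} → Formula k → (Fin k → M) → Set (a ⊔ b)
Sat {a} {b} R (rel i j) env = Level.Lift a (R (env i) (env j))
Sat {a} {b} R (eq i j)  env = Level.Lift b (env i ≡ env j)
Sat {a} {b} R falsum    env = Level.Lift (a ⊔ b) ⊥
Sat R (neg φ)   env = ¬ Sat R φ env
Sat R (and φ ψ) env = Sat R φ env × Sat R ψ env
Sat R (or φ ψ)  env = Sat R φ env ⊎ Sat R ψ env
Sat R (imp φ ψ) env = Sat R φ env → Sat R ψ env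
Sat {M = M} R (all φ) env = (x : M) → Sat R φ (extend x env)
Sat {M = M} R (ex φ)  env = Σ M λ x → Sat R φ (extend x env)

env2 : ∀ {a} {M : Set a} → M → M → Fin 2 → M
env2 p q Fin.zero          = p
env2 p q (Fin.suc Fin.zero) = q

Definable : ∀ {a b r} {M : Set a} (R : Rel M b) (S : Rel M r) → Set (a ⊔ b ⊔ r)
Definable R S = ∃[ φ ] (∀ p q → S p q ⇔ Sat R φ (env2 p q))

data RhoName : Set where
  τ λ' σ : RhoName

data BasicName : Set where
  τb σb λb eqb : BasicName

module Named {c ℓ} (F : OrderedField c ℓ) where
  open Space F

  ⟦_⟧ρ : ∀ {m} → RhoName → Rel (Point (suc m)) (c ⊔ ℓ)
  ⟦ τ  ⟧ρ p q = Level.Lift (c ⊔ ℓ) (τ-rel p q)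
  ⟦ λ' ⟧ρ p q = Level.Lift (c ⊔ ℓ) (λ-rel p q)
  ⟦ σ  ⟧ρ p q = Level.Lift (c ⊔ ℓ) (σ-rel p q)

  ⟦_⟧b : ∀ {m} → BasicName → Rel (Point (suc m)) (c ⊔ ℓ)
  ⟦ τb  ⟧b p q = Level.Lift (c ⊔ ℓ) (τ-rel p q)
  ⟦ σb  ⟧b p q = Level.Lift (c ⊔ ℓ) (σ-rel p q)
  ⟦ λb  ⟧b p q = Level.Lift (c ⊔ ℓ) (λ-rel p q)
  ⟦ eqb ⟧b p q = Level.Lift (c ⊔ ℓ) (p ≡ q)

  IsUnionOf : ∀ {m r} → (BasicName → Bool) → Rel (Point (suc m)) r → Set (c ⊔ ℓ ⊔ r)
  IsUnionOf sel S = ∀ p q → S p q ⇔ (∃[ b ] (sel b ≡ true × ⟦ b ⟧b p q))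

-- A bijection f of Fⁿ with Q(f p − f q) = k Q(p − q) for some k > 0, where Q(v) = v₀² − Σ vᵢ² is
-- the Minkowski form, maps each of τ, λ, σ onto itself, so it is an automorphism of (Fⁿ, ρ), and
-- definable relations are invariant under automorphisms. Translations, Minkowski reflections in
-- non-null vectors and, for every k > 0, such a map with ratio k fixing the origin (a dilation by
-- √k when F is Euclidean; in the plane a boost (t, x) ↦ (at + bx, bt + ax) with a² − b² = k) move
-- every pair in τ, σ, λ or = to a fixed representative of its class. Hence a definable relation
-- contains each of these classes that it meets.

module Submission where

open import Level using (_⊔_; Lift; lift; lower)
open import Algebra.Bundles using (CommutativeRing)
open import Algebra.Structures using (IsCommutativeRing)
open import Algebra.Solver.Ring.AlmostCommutativeRing using (_-Raw-AlmostCommutative⟶_; fromCommutativeRing)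
import Algebra.Properties.Group as GroupProperties
import Algebra.Properties.Ring as RingProperties
import Algebra.Properties.Semiring.Mult.TCOptimised as SemiringMultiplication
import Algebra.Solver.Ring as RingSolver
open import Axiom.ExcludedMiddle using (ExcludedMiddle)
open import Data.Bool using (Bool; true)
open import Data.Bool.Properties using (T-≡)
open import Data.Empty using (⊥-elim)
open import Data.Fin using (Fin)
open import Data.Integer as ℤ using (ℤ; -[1+_])
import Data.Integer.Properties as ℤ
open import Data.Maybe using (map)
open import Data.Nat as ℕ using (ℕ; zero; suc)
import Data.Nat.Properties as ℕ
open import Data.Product using (Σ; ∃-syntax; _×_; _,_; proj₁; proj₂)
open import Data.Sign as Sign using ()
open import Data.Sum using (_⊎_; inj₁; inj₂)
open import Data.Vec using ([]; _∷_; head; tail)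
open import Function.Base using (_∘_)
open import Function.Bundles using (_⇔_; mk⇔; Equivalence)
open import Relation.Binary using (Rel; Decidable; IsTotalOrder)
open import Relation.Binary.Consequences using (dec⇒weaklyDec)
open import Relation.Binary.Definitions using (DecidableEquality)
open import Relation.Binary.PropositionalEquality
open import Relation.Nullary using (¬_; Dec; yes; no)
open import Relation.Nullary.Decidable as Dec using (isYes; toWitness; fromWitness)

open import Defs

-- In Defs, _-_ and _<_ have no fixity declaration: both bind tighter than _*_ and _+_,
-- hence the parentheses around differences and around the right side of _<_.
module OrderedFieldProperties {c ℓ} (F : OrderedField c ℓ) where

  open OrderedField F public
  open IsCommutativeRing isCommutativeRing public
    using ( +-assoc; +-comm; *-assoc; *-comm
          ; +-identityˡ; +-identityʳ; *-identityˡ; *-identityʳ; -‿inverseʳ; zeroˡ; zeroʳ)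
  open IsTotalOrder isTotalOrder public
    using () renaming (refl to ≤-refl; trans to ≤-trans; antisym to ≤-antisym; total to ≤-total)
  open ≡-Reasoning

  commutativeRing : CommutativeRing c c
  commutativeRing = record { isCommutativeRing = isCommutativeRing }

  open CommutativeRing commutativeRing using (ring; semiring; +-group)
  open RingProperties ring public
    using (-0#≈0#; -‿involutive; -‿+-comm; -‿distribˡ-*; -‿distribʳ-*)
  open GroupProperties +-group using (x∙y⁻¹≈ε⇒x≈y; x≈y⇒x∙y⁻¹≈ε)
  open SemiringMultiplication semiring using (1+×; ×-homo-+; ×1-homo-*) renaming (_×_ to _×ᴺ_)

  -- Built from the type-checking-optimised multiple, so that the solver's constant
  -- con (ℤ.+ 2) is literally 1# + 1#, i.e. two.
  ⟦_⟧ℤ : ℤ → Carrier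
  ⟦ ℤ.+ n ⟧ℤ    = n ×ᴺ 1#
  ⟦ -[1+ n ] ⟧ℤ = - (suc n ×ᴺ 1#)

  private
    [z+x]-[z+y]≡x-y : ∀ x y z → (z + x) - (z + y) ≡ x - y
    [z+x]-[z+y]≡x-y x y z = begin
      (z + x) + - (z + y)   ≡⟨ cong ((z + x) +_) (sym (-‿+-comm z y)) ⟩
      (z + x) + (- z + - y) ≡⟨ +-assoc z x _ ⟩
      z + (x + (- z + - y)) ≡⟨ cong (z +_) (sym (+-assoc x (- z) (- y))) ⟩
      z + ((x + - z) + - y) ≡⟨ cong (λ t → z + (t + - y)) (+-comm x (- z)) ⟩
      z + ((- z + x) + - y) ≡⟨ cong (z +_) (+-assoc (- z) x (- y)) ⟩
      z + (- z + (x + - y)) ≡⟨ sym (+-assoc z (- z) _) ⟩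
      (z + - z) + (x - y)   ≡⟨ cong (_+ (x - y)) (-‿inverseʳ z) ⟩
      0# + (x - y)          ≡⟨ +-identityˡ _ ⟩
      x - y                 ∎

    ⊖-homo : ∀ m n → ⟦ m ℤ.⊖ n ⟧ℤ ≡ (m ×ᴺ 1#) - (n ×ᴺ 1#)
    ⊖-homo zero    zero    = sym (-‿inverseʳ 0#)
    ⊖-homo (suc m) zero    = sym (trans (cong (suc m ×ᴺ 1# +_) -0#≈0#) (+-identityʳ _))
    ⊖-homo zero    (suc n) = sym (+-identityˡ _)
    ⊖-homo (suc m) (suc n) = begin
      ⟦ suc m ℤ.⊖ suc n ⟧ℤ              ≡⟨ cong ⟦_⟧ℤ (ℤ.[1+m]⊖[1+n]≡m⊖n m n) ⟩
      ⟦ m ℤ.⊖ n ⟧ℤ                      ≡⟨ ⊖-homo m n ⟩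
      (m ×ᴺ 1#) - (n ×ᴺ 1#)             ≡⟨ sym ([z+x]-[z+y]≡x-y _ _ 1#) ⟩
      (1# + m ×ᴺ 1#) - (1# + n ×ᴺ 1#)   ≡⟨ sym (cong₂ _-_ (1+× m 1#) (1+× n 1#)) ⟩
      (suc m ×ᴺ 1#) - (suc n ×ᴺ 1#)     ∎

    +-homo : ∀ i j → ⟦ i ℤ.+ j ⟧ℤ ≡ ⟦ i ⟧ℤ + ⟦ j ⟧ℤ
    +-homo -[1+ m ] -[1+ n ] = begin
      - (suc (suc (m ℕ.+ n)) ×ᴺ 1#)  ≡⟨ cong (λ k → - (suc k ×ᴺ 1#)) (sym (ℕ.+-suc m n)) ⟩
      - ((suc m ℕ.+ suc n) ×ᴺ 1#)    ≡⟨ cong -_ (×-homo-+ 1# (suc m) (suc n)) ⟩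
      - (suc m ×ᴺ 1# + suc n ×ᴺ 1#)  ≡⟨ sym (-‿+-comm _ _) ⟩
      - (suc m ×ᴺ 1#) + - (suc n ×ᴺ 1#) ∎
    +-homo -[1+ m ] (ℤ.+ n)  = trans (⊖-homo n (suc m)) (+-comm _ _)
    +-homo (ℤ.+ m)  -[1+ n ] = ⊖-homo m (suc n)
    +-homo (ℤ.+ m)  (ℤ.+ n)  = ×-homo-+ 1# m n

    -‿homo : ∀ i → ⟦ ℤ.- i ⟧ℤ ≡ - ⟦ i ⟧ℤ
    -‿homo (ℤ.+ zero)  = sym -0#≈0#
    -‿homo (ℤ.+ suc n) = refl
    -‿homo -[1+ n ]    = sym (-‿involutive _)

    +◃-homo : ∀ n → ⟦ Sign.+ ℤ.◃ n ⟧ℤ ≡ n ×ᴺ 1#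
    +◃-homo zero    = refl
    +◃-homo (suc n) = refl

    -◃-homo : ∀ n → ⟦ Sign.- ℤ.◃ n ⟧ℤ ≡ - (n ×ᴺ 1#)
    -◃-homo zero    = sym -0#≈0#
    -◃-homo (suc n) = refl

    *-homo : ∀ i j → ⟦ i ℤ.* j ⟧ℤ ≡ ⟦ i ⟧ℤ * ⟦ j ⟧ℤ
    *-homo (ℤ.+ m) (ℤ.+ n) = trans (+◃-homo (m ℕ.* n)) (×1-homo-* m n)
    *-homo (ℤ.+ m) -[1+ n ] = begin
      ⟦ Sign.- ℤ.◃ (m ℕ.* suc n) ⟧ℤ ≡⟨ -◃-homo (m ℕ.* suc n) ⟩
      - ((m ℕ.* suc n) ×ᴺ 1#)       ≡⟨ cong -_ (×1-homo-* m (suc n)) ⟩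
      - (m ×ᴺ 1# * suc n ×ᴺ 1#)      ≡⟨ -‿distribʳ-* _ _ ⟩
      m ×ᴺ 1# * - (suc n ×ᴺ 1#)      ∎
    *-homo -[1+ m ] (ℤ.+ n) = begin
      ⟦ Sign.- ℤ.◃ (suc m ℕ.* n) ⟧ℤ ≡⟨ -◃-homo (suc m ℕ.* n) ⟩
      - ((suc m ℕ.* n) ×ᴺ 1#)       ≡⟨ cong -_ (×1-homo-* (suc m) n) ⟩
      - (suc m ×ᴺ 1# * n ×ᴺ 1#)      ≡⟨ -‿distribˡ-* _ _ ⟩
      - (suc m ×ᴺ 1#) * n ×ᴺ 1#      ∎
    *-homo -[1+ m ] -[1+ n ] = begin
      (suc m ℕ.* suc n) ×ᴺ 1#              ≡⟨ ×1-homo-* (suc m) (suc n) ⟩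
      suc m ×ᴺ 1# * suc n ×ᴺ 1#             ≡⟨ sym (-‿involutive _) ⟩
      - - (suc m ×ᴺ 1# * suc n ×ᴺ 1#)       ≡⟨ cong -_ (-‿distribˡ-* _ _) ⟩
      - (- (suc m ×ᴺ 1#) * suc n ×ᴺ 1#)     ≡⟨ -‿distribʳ-* _ _ ⟩
      - (suc m ×ᴺ 1#) * - (suc n ×ᴺ 1#)     ∎

  ℤ-morphism : ℤ.+-*-rawRing -Raw-AlmostCommutative⟶ fromCommutativeRing commutativeRing
  ℤ-morphism = record
    { ⟦_⟧ = ⟦_⟧ℤ ; +-homo = +-homo ; *-homo = *-homo ; -‿homo = -‿homo
    ; 0-homo = refl ; 1-homo = refl }

  open RingSolver ℤ.+-*-rawRing (fromCommutativeRing commutativeRing) ℤ-morphism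
    (λ i j → map (cong ⟦_⟧ℤ) (dec⇒weaklyDec ℤ._≟_ i j)) public
    using (solve; _:=_; con; _:+_; _:*_; _:-_; :-_)

  two : Carrier
  two = 1# + 1#

  x-y≡0⇒x≡y : ∀ {x y} → x - y ≡ 0# → x ≡ y
  x-y≡0⇒x≡y = x∙y⁻¹≈ε⇒x≈y _ _

  x≡y⇒x-y≡0 : ∀ {x y} → x ≡ y → x - y ≡ 0#
  x≡y⇒x-y≡0 = x≈y⇒x∙y⁻¹≈ε

  x≡[x-y]+z⇒z≡y : ∀ {x y z} → x ≡ (x - y) + z → z ≡ y
  x≡[x-y]+z⇒z≡y {x} {y} {z} x≡[x-y]+z = begin
    z                         ≡⟨ solve 3 (λ x y z → z := y :+ (((x :- y) :+ z) :- x)) refl x y z ⟩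
    y + (((x - y) + z) - x)   ≡⟨ cong (λ t → y + (t - x)) (sym x≡[x-y]+z) ⟩
    y + (x - x)               ≡⟨ cong (y +_) (-‿inverseʳ x) ⟩
    y + 0#                    ≡⟨ +-identityʳ y ⟩
    y                         ∎

  x≤y⇒0≤y-x : ∀ {x y} → x ≤ y → 0# ≤ y - x
  x≤y⇒0≤y-x {x} x≤y = subst (_≤ _) (-‿inverseʳ x) (+-mono-≤ (- x) x≤y)

  0≤y-x⇒x≤y : ∀ {x y} → 0# ≤ y - x → x ≤ y
  0≤y-x⇒x≤y {x} {y} 0≤y-x =
    subst₂ _≤_ (+-identityˡ x) (solve 2 (λ x y → (y :- x) :+ x := y) refl x y) (+-mono-≤ x 0≤y-x)

  x<y⇒0<y-x : ∀ {x y} → x < y → 0# < (y - x)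
  x<y⇒0<y-x (x≤y , x≢y) = x≤y⇒0≤y-x x≤y , λ 0≡y-x → x≢y (sym (x-y≡0⇒x≡y (sym 0≡y-x)))

  0<y-x⇒x<y : ∀ {x y} → 0# < (y - x) → x < y
  0<y-x⇒x<y (0≤y-x , 0≢y-x) = 0≤y-x⇒x≤y 0≤y-x , λ x≡y → 0≢y-x (sym (x≡y⇒x-y≡0 (sym x≡y)))

  x≤0⇒0≤-x : ∀ {x} → x ≤ 0# → 0# ≤ - x
  x≤0⇒0≤-x x≤0 = subst (0# ≤_) (+-identityˡ _) (x≤y⇒0≤y-x x≤0)

  0≤x*x : ∀ x → 0# ≤ x * x
  0≤x*x x with ≤-total 0# x
  ... | inj₁ 0≤x = *-nonneg 0≤x 0≤x
  ... | inj₂ x≤0 = subst (0# ≤_) (solve 1 (λ x → (:- x) :* (:- x) := x :* x) refl x)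
                         (*-nonneg (x≤0⇒0≤-x x≤0) (x≤0⇒0≤-x x≤0))

  0≤1 : 0# ≤ 1#
  0≤1 = subst (0# ≤_) (*-identityˡ 1#) (0≤x*x 1#)

  0<1 : 0# < 1#
  0<1 = 0≤1 , 0≢1

  1≰0 : ¬ 1# ≤ 0#
  1≰0 1≤0 = 0≢1 (≤-antisym 0≤1 1≤0)

  0<2 : 0# < two
  0<2 = ≤-trans 0≤1 1≤2 , λ 0≡2 → 1≰0 (subst (1# ≤_) (sym 0≡2) 1≤2)
    where
    1≤2 : 1# ≤ two
    1≤2 = subst (_≤ two) (+-identityˡ 1#) (+-mono-≤ 1# 0≤1)

  x≥0∧y≥0∧x+y≡0⇒x≡0 : ∀ {x y} → 0# ≤ x → 0# ≤ y → x + y ≡ 0# → x ≡ 0#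
  x≥0∧y≥0∧x+y≡0⇒x≡0 {x} 0≤x 0≤y x+y≡0 =
    ≤-antisym (subst₂ _≤_ (+-identityˡ x) (trans (+-comm _ x) x+y≡0) (+-mono-≤ x 0≤y)) 0≤x

  inv : ∀ x → x ≢ 0# → Carrier
  inv x x≢0 = proj₁ (inverse x x≢0)

  x*inv≡1 : ∀ x x≢0 → x * inv x x≢0 ≡ 1#
  x*inv≡1 x x≢0 = proj₂ (inverse x x≢0)

  inv*x≡1 : ∀ x x≢0 → inv x x≢0 * x ≡ 1#
  inv*x≡1 x x≢0 = trans (*-comm _ x) (x*inv≡1 x x≢0)

  x*y≡0⇒y≡0 : ∀ {x y} → x * y ≡ 0# → x ≢ 0# → y ≡ 0#
  x*y≡0⇒y≡0 {x} {y} x*y≡0 x≢0 = begin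
    y                      ≡⟨ sym (*-identityˡ y) ⟩
    1# * y                 ≡⟨ cong (_* y) (sym (inv*x≡1 x x≢0)) ⟩
    (inv x x≢0 * x) * y    ≡⟨ *-assoc _ x y ⟩
    inv x x≢0 * (x * y)    ≡⟨ cong (inv x x≢0 *_) x*y≡0 ⟩
    inv x x≢0 * 0#         ≡⟨ zeroʳ _ ⟩
    0#                     ∎

  *-≢0 : ∀ {x y} → x ≢ 0# → y ≢ 0# → x * y ≢ 0#
  *-≢0 x≢0 y≢0 x*y≡0 = y≢0 (x*y≡0⇒y≡0 x*y≡0 x≢0)

  x*x≡0⇒x≡0 : ∀ {x} → Dec (x ≡ 0#) → x * x ≡ 0# → x ≡ 0#
  x*x≡0⇒x≡0 (yes x≡0) _     = x≡0
  x*x≡0⇒x≡0 (no x≢0)  x*x≡0 = ⊥-elim (*-≢0 x≢0 x≢0 x*x≡0)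

  inv-≢0 : ∀ x x≢0 → inv x x≢0 ≢ 0#
  inv-≢0 x x≢0 inv≡0 = 0≢1 (trans (sym (zeroʳ x)) (trans (cong (x *_) (sym inv≡0)) (x*inv≡1 x x≢0)))

  2≢0 : two ≢ 0#
  2≢0 2≡0 = proj₂ 0<2 (sym 2≡0)

  -1≢0 : - 1# ≢ 0#
  -1≢0 -1≡0 = 0≢1 (sym (trans (sym (-‿involutive 1#)) (trans (cong -_ -1≡0) -0#≈0#)))

  *-pos : ∀ {x y} → 0# < x → 0# < y → 0# < (x * y)
  *-pos (0≤x , 0≢x) (0≤y , 0≢y) = *-nonneg 0≤x 0≤y , ≢-sym (*-≢0 (≢-sym 0≢x) (≢-sym 0≢y))

  inv-pos : ∀ {x} (0<x : 0# < x) → 0# < inv x (≢-sym (proj₂ 0<x))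
  inv-pos {x} (0≤x , 0≢x) with ≤-total 0# (inv x (≢-sym 0≢x))
  ... | inj₁ 0≤i = 0≤i , ≢-sym (inv-≢0 x _)
  ... | inj₂ i≤0 = ⊥-elim (1≰0 (subst₂ _≤_ (+-identityˡ 1#) x*-i+1≡0 (+-mono-≤ 1# x*-i≥0)))
    where
    i = inv x (≢-sym 0≢x)
    x*-i≥0 : 0# ≤ x * - i
    x*-i≥0 = *-nonneg 0≤x (x≤0⇒0≤-x i≤0)
    x*-i+1≡0 : x * - i + 1# ≡ 0#
    x*-i+1≡0 = trans (solve 2 (λ x i → x :* (:- i) :+ con (ℤ.+ 1) := con (ℤ.+ 1) :- x :* i) refl x i)
                     (x≡y⇒x-y≡0 (sym (x*inv≡1 x _)))

  x+y*[z-1]≡x : ∀ x y {z} → z ≡ 1# → x + y * (z - 1#) ≡ x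
  x+y*[z-1]≡x x y refl = solve 2 (λ x y → x :+ y :* (con (ℤ.+ 1) :- con (ℤ.+ 1)) := x) refl x y

module _ {a b} {M : Set a} (R : Rel M b) where

  record Automorphism : Set (a ⊔ b) where
    field
      to from   : M → M
      to-from   : ∀ x → to (from x) ≡ x
      from-to   : ∀ x → from (to x) ≡ x
      preserves : ∀ {x y} → R x y → R (to x) (to y)
      reflects  : ∀ {x y} → R (to x) (to y) → R x y

  private
    extend-cong : ∀ {k} x {env env′ : Fin k → M} → (∀ i → env i ≡ env′ i) →
                  ∀ i → extend x env i ≡ extend x env′ i
    extend-cong x ≗env Fin.zero    = refl
    extend-cong x ≗env (Fin.suc i) = ≗env i

  sat-cong : ∀ {k} (φ : Formula k) {env env′ : Fin k → M} →
             (∀ i → env i ≡ env′ i) → Sat R φ env → Sat R φ env′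
  sat-cong (rel i j) ≗env (lift r)   = lift (subst₂ R (≗env i) (≗env j) r)
  sat-cong (eq i j)  ≗env (lift e)   = lift (trans (sym (≗env i)) (trans e (≗env j)))
  sat-cong falsum    ≗env s          = s
  sat-cong (neg φ)   ≗env s          = λ t → s (sat-cong φ (λ i → sym (≗env i)) t)
  sat-cong (and φ ψ) ≗env (s , t)    = sat-cong φ ≗env s , sat-cong ψ ≗env t
  sat-cong (or φ ψ)  ≗env (inj₁ s)   = inj₁ (sat-cong φ ≗env s)
  sat-cong (or φ ψ)  ≗env (inj₂ s)   = inj₂ (sat-cong ψ ≗env s)
  sat-cong (imp φ ψ) ≗env s          = λ t → sat-cong ψ ≗env (s (sat-cong φ (λ i → sym (≗env i)) t))
  sat-cong (all φ)   ≗env s          = λ x → sat-cong φ (extend-cong x ≗env) (s x)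
  sat-cong (ex φ)    ≗env (x , s)    = x , sat-cong φ (extend-cong x ≗env) s

  module _ (A : Automorphism) where
    open Automorphism A

    private
      to-extend : ∀ {k} x (env : Fin k → M) i → to (extend x env i) ≡ extend (to x) (to ∘ env) i
      to-extend x env Fin.zero    = refl
      to-extend x env (Fin.suc i) = refl

      to-extend-from : ∀ {k} x (env : Fin k → M) i →
                       to (extend (from x) env i) ≡ extend x (to ∘ env) i
      to-extend-from x env Fin.zero    = to-from x
      to-extend-from x env (Fin.suc i) = refl

    sat-to   : ∀ {k} (φ : Formula k) env → Sat R φ env → Sat R φ (to ∘ env)
    sat-from : ∀ {k} (φ : Formula k) env → Sat R φ (to ∘ env) → Sat R φ env

    sat-to (rel i j) env (lift r) = lift (preserves r)
    sat-to (eq i j)  env (lift e) = lift (cong to e)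
    sat-to falsum    env s        = s
    sat-to (neg φ)   env s        = λ t → s (sat-from φ env t)
    sat-to (and φ ψ) env (s , t)  = sat-to φ env s , sat-to ψ env t
    sat-to (or φ ψ)  env (inj₁ s) = inj₁ (sat-to φ env s)
    sat-to (or φ ψ)  env (inj₂ s) = inj₂ (sat-to ψ env s)
    sat-to (imp φ ψ) env s        = λ t → sat-to ψ env (s (sat-from φ env t))
    sat-to (all φ)   env s        = λ x →
      sat-cong φ (to-extend-from x env) (sat-to φ (extend (from x) env) (s (from x)))
    sat-to (ex φ)    env (x , s)  = to x , sat-cong φ (to-extend x env) (sat-to φ (extend x env) s)

    sat-from (rel i j) env (lift r) = lift (reflects r)
    sat-from (eq i j)  env (lift e) = lift (trans (sym (from-to _)) (trans (cong from e) (from-to _)))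
    sat-from falsum    env s        = s
    sat-from (neg φ)   env s        = λ t → s (sat-to φ env t)
    sat-from (and φ ψ) env (s , t)  = sat-from φ env s , sat-from ψ env t
    sat-from (or φ ψ)  env (inj₁ s) = inj₁ (sat-from φ env s)
    sat-from (or φ ψ)  env (inj₂ s) = inj₂ (sat-from ψ env s)
    sat-from (imp φ ψ) env s        = λ t → sat-from ψ env (s (sat-to φ env t))
    sat-from (all φ)   env s        = λ x →
      sat-from φ (extend x env) (sat-cong φ (λ i → sym (to-extend x env i)) (s (to x)))
    sat-from (ex φ)    env (x , s)  = from x ,
      sat-from φ (extend (from x) env) (sat-cong φ (λ i → sym (to-extend-from x env i)) s)

    private
      to-env2 : ∀ p q i → to (env2 p q i) ≡ env2 (to p) (to q) i
      to-env2 p q Fin.zero            = refl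
      to-env2 p q (Fin.suc Fin.zero) = refl

    definable-invariant : ∀ {r} {S : Rel M r} → Definable R S → ∀ p q → S p q ⇔ S (to p) (to q)
    definable-invariant (φ , S⇔φ) p q = mk⇔
      (λ s → Equivalence.from (S⇔φ _ _)
               (sat-cong φ (to-env2 p q) (sat-to φ (env2 p q) (Equivalence.to (S⇔φ p q) s))))
      (λ s → Equivalence.from (S⇔φ p q)
               (sat-from φ (env2 p q) (sat-cong φ (λ i → sym (to-env2 p q i)) (Equivalence.to (S⇔φ _ _) s))))

module MinkowskiSpace {c ℓ} (F : OrderedField c ℓ) (_≟_ : DecidableEquality (OrderedField.Carrier F)) where

  open OrderedFieldProperties F
  open Space F using (Point; sumSqDiff; timeSq; spaceSq; τ-rel; λ-rel; σ-rel)
  open ≡-Reasoning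

  infixl 6 _⊕_ _⊖_
  infixr 7 _⊙_
  infix  8 _·_

  𝟎 : ∀ {n} → Point n
  𝟎 {zero}  = []
  𝟎 {suc n} = 0# ∷ 𝟎

  _⊕_ _⊖_ : ∀ {n} → Point n → Point n → Point n
  []       ⊕ []       = []
  (x ∷ xs) ⊕ (y ∷ ys) = (x + y) ∷ (xs ⊕ ys)
  []       ⊖ []       = []
  (x ∷ xs) ⊖ (y ∷ ys) = (x - y) ∷ (xs ⊖ ys)

  _⊙_ : ∀ {n} → Carrier → Point n → Point n
  s ⊙ []       = []
  s ⊙ (x ∷ xs) = (s * x) ∷ (s ⊙ xs)

  _·_ : ∀ {n} → Point n → Point n → Carrier
  []       · []       = 0#
  (x ∷ xs) · (y ∷ ys) = x * y + xs · ys

  ⟨_,_⟩ : ∀ {n} → Point (suc n) → Point (suc n) → Carrier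
  ⟨ x ∷ xs , y ∷ ys ⟩ = (x * y) - (xs · ys)

  ‖_‖² : ∀ {n} → Point (suc n) → Carrier
  ‖ v ‖² = ⟨ v , v ⟩

  private
    ∷-cong : ∀ {n} {x y : Carrier} {xs ys : Point n} → x ≡ y → xs ≡ ys → x ∷ xs ≡ y ∷ ys
    ∷-cong = cong₂ _∷_

  [x⊖z]⊖[y⊖z]≡x⊖y : ∀ {n} (x y z : Point n) → (x ⊖ z) ⊖ (y ⊖ z) ≡ x ⊖ y
  [x⊖z]⊖[y⊖z]≡x⊖y []       []       []       = refl
  [x⊖z]⊖[y⊖z]≡x⊖y (x ∷ xs) (y ∷ ys) (z ∷ zs) =
    ∷-cong (solve 3 (λ x y z → (x :- z) :- (y :- z) := x :- y) refl x y z) ([x⊖z]⊖[y⊖z]≡x⊖y xs ys zs)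

  [x⊕y]⊖y≡x : ∀ {n} (x y : Point n) → (x ⊕ y) ⊖ y ≡ x
  [x⊕y]⊖y≡x []       []       = refl
  [x⊕y]⊖y≡x (x ∷ xs) (y ∷ ys) = ∷-cong (solve 2 (λ x y → (x :+ y) :- y := x) refl x y) ([x⊕y]⊖y≡x xs ys)

  [x⊖y]⊕y≡x : ∀ {n} (x y : Point n) → (x ⊖ y) ⊕ y ≡ x
  [x⊖y]⊕y≡x []       []       = refl
  [x⊖y]⊕y≡x (x ∷ xs) (y ∷ ys) = ∷-cong (solve 2 (λ x y → (x :- y) :+ y := x) refl x y) ([x⊖y]⊕y≡x xs ys)

  x⊖x≡𝟎 : ∀ {n} (x : Point n) → x ⊖ x ≡ 𝟎
  x⊖x≡𝟎 []       = refl
  x⊖x≡𝟎 (x ∷ xs) = ∷-cong (-‿inverseʳ x) (x⊖x≡𝟎 xs)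

  x⊖𝟎≡x : ∀ {n} (x : Point n) → x ⊖ 𝟎 ≡ x
  x⊖𝟎≡x []       = refl
  x⊖𝟎≡x (x ∷ xs) = ∷-cong (solve 1 (λ x → x :- con (ℤ.+ 0) := x) refl x) (x⊖𝟎≡x xs)

  x⊖y≡𝟎⇒x≡y : ∀ {n} (x y : Point n) → x ⊖ y ≡ 𝟎 → x ≡ y
  x⊖y≡𝟎⇒x≡y []       []       _   = refl
  x⊖y≡𝟎⇒x≡y (x ∷ xs) (y ∷ ys) x⊖y≡𝟎 =
    ∷-cong (x-y≡0⇒x≡y (cong head x⊖y≡𝟎)) (x⊖y≡𝟎⇒x≡y xs ys (cong tail x⊖y≡𝟎))

  s⊙x⊖s⊙y≡s⊙[x⊖y] : ∀ {n} s (x y : Point n) → s ⊙ x ⊖ s ⊙ y ≡ s ⊙ (x ⊖ y)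
  s⊙x⊖s⊙y≡s⊙[x⊖y] s []       []       = refl
  s⊙x⊖s⊙y≡s⊙[x⊖y] s (x ∷ xs) (y ∷ ys) =
    ∷-cong (solve 3 (λ s x y → s :* x :- s :* y := s :* (x :- y)) refl s x y) (s⊙x⊖s⊙y≡s⊙[x⊖y] s xs ys)

  s⊙[t⊙x]≡[s*t]⊙x : ∀ {n} s t (x : Point n) → s ⊙ (t ⊙ x) ≡ (s * t) ⊙ x
  s⊙[t⊙x]≡[s*t]⊙x s t []       = refl
  s⊙[t⊙x]≡[s*t]⊙x s t (x ∷ xs) = ∷-cong (sym (*-assoc s t x)) (s⊙[t⊙x]≡[s*t]⊙x s t xs)

  1⊙x≡x : ∀ {n} (x : Point n) → 1# ⊙ x ≡ x
  1⊙x≡x []       = refl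
  1⊙x≡x (x ∷ xs) = ∷-cong (*-identityˡ x) (1⊙x≡x xs)

  0⊙x≡𝟎 : ∀ {n} (x : Point n) → 0# ⊙ x ≡ 𝟎
  0⊙x≡𝟎 []       = refl
  0⊙x≡𝟎 (x ∷ xs) = ∷-cong (zeroˡ x) (0⊙x≡𝟎 xs)

  s⊙𝟎≡𝟎 : ∀ {n} s → s ⊙ 𝟎 {n} ≡ 𝟎
  s⊙𝟎≡𝟎 {zero}  s = refl
  s⊙𝟎≡𝟎 {suc n} s = ∷-cong (zeroʳ s) (s⊙𝟎≡𝟎 s)

  [x⊖a⊙w]⊖[y⊖b⊙w]≡[x⊖y]⊖[a-b]⊙w : ∀ {n} (x y w : Point n) a b →
                                   (x ⊖ a ⊙ w) ⊖ (y ⊖ b ⊙ w) ≡ (x ⊖ y) ⊖ (a - b) ⊙ w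
  [x⊖a⊙w]⊖[y⊖b⊙w]≡[x⊖y]⊖[a-b]⊙w []       []       []       a b = refl
  [x⊖a⊙w]⊖[y⊖b⊙w]≡[x⊖y]⊖[a-b]⊙w (x ∷ xs) (y ∷ ys) (w ∷ ws) a b = ∷-cong
    (solve 5 (λ x y w a b → (x :- a :* w) :- (y :- b :* w) := (x :- y) :- (a :- b) :* w) refl x y w a b)
    ([x⊖a⊙w]⊖[y⊖b⊙w]≡[x⊖y]⊖[a-b]⊙w xs ys ws a b)

  [x⊖a⊙w]⊖b⊙w≡x⊖[a+b]⊙w : ∀ {n} (x w : Point n) a b → (x ⊖ a ⊙ w) ⊖ b ⊙ w ≡ x ⊖ (a + b) ⊙ w
  [x⊖a⊙w]⊖b⊙w≡x⊖[a+b]⊙w []       []       a b = refl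
  [x⊖a⊙w]⊖b⊙w≡x⊖[a+b]⊙w (x ∷ xs) (w ∷ ws) a b = ∷-cong
    (solve 4 (λ x w a b → (x :- a :* w) :- b :* w := x :- (a :+ b) :* w) refl x w a b)
    ([x⊖a⊙w]⊖b⊙w≡x⊖[a+b]⊙w xs ws a b)

  x⊖[x⊖y]≡y : ∀ {n} (x y : Point n) → x ⊖ (x ⊖ y) ≡ y
  x⊖[x⊖y]≡y []       []       = refl
  x⊖[x⊖y]≡y (x ∷ xs) (y ∷ ys) = ∷-cong (solve 2 (λ x y → x :- (x :- y) := y) refl x y) (x⊖[x⊖y]≡y xs ys)

  ·-comm : ∀ {n} (x y : Point n) → x · y ≡ y · x
  ·-comm []       []       = refl
  ·-comm (x ∷ xs) (y ∷ ys) = cong₂ _+_ (*-comm x y) (·-comm xs ys)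

  ·-distribʳ-⊖ : ∀ {n} (x y z : Point n) → (x ⊖ y) · z ≡ (x · z) - (y · z)
  ·-distribʳ-⊖ []       []       []       = sym (-‿inverseʳ 0#)
  ·-distribʳ-⊖ (x ∷ xs) (y ∷ ys) (z ∷ zs) = begin
    (x - y) * z + (xs ⊖ ys) · zs
      ≡⟨ cong ((x - y) * z +_) (·-distribʳ-⊖ xs ys zs) ⟩
    (x - y) * z + ((xs · zs) - (ys · zs))
      ≡⟨ solve 5 (λ x y z a b → (x :- y) :* z :+ (a :- b) := (x :* z :+ a) :- (y :* z :+ b))
                 refl x y z (xs · zs) (ys · zs) ⟩
    (x * z + xs · zs) - (y * z + ys · zs)
      ∎

  ⊙-· : ∀ {n} s (x y : Point n) → (s ⊙ x) · y ≡ s * (x · y)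
  ⊙-· s []       []       = sym (zeroʳ s)
  ⊙-· s (x ∷ xs) (y ∷ ys) = begin
    s * x * y + (s ⊙ xs) · ys   ≡⟨ cong (s * x * y +_) (⊙-· s xs ys) ⟩
    s * x * y + s * (xs · ys)   ≡⟨ solve 4 (λ s x y a → s :* x :* y :+ s :* a := s :* (x :* y :+ a))
                                           refl s x y (xs · ys) ⟩
    s * (x * y + xs · ys)       ∎

  𝟎·x≡0 : ∀ {n} (x : Point n) → 𝟎 · x ≡ 0#
  𝟎·x≡0 []       = refl
  𝟎·x≡0 (x ∷ xs) = trans (cong₂ _+_ (zeroˡ x) (𝟎·x≡0 xs)) (+-identityˡ 0#)

  0≤x·x : ∀ {n} (x : Point n) → 0# ≤ x · x
  0≤x·x []       = ≤-refl
  0≤x·x (x ∷ xs) = ≤-trans (0≤x*x x) (subst₂ _≤_ (+-identityʳ (x * x)) refl (+-mono≤ˡ (0≤x·x xs)))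
    where
    +-mono≤ˡ : ∀ {a b} → a ≤ b → x * x + a ≤ x * x + b
    +-mono≤ˡ {a} {b} a≤b = subst₂ _≤_ (+-comm a _) (+-comm b _) (+-mono-≤ (x * x) a≤b)

  x·x≡0⇒x≡𝟎 : ∀ {n} (x : Point n) → x · x ≡ 0# → x ≡ 𝟎
  x·x≡0⇒x≡𝟎 []       _      = refl
  x·x≡0⇒x≡𝟎 (x ∷ xs) x·x≡0 = ∷-cong
    (x*x≡0⇒x≡0 (x ≟ 0#) (x≥0∧y≥0∧x+y≡0⇒x≡0 (0≤x*x x) (0≤x·x xs) x·x≡0))
    (x·x≡0⇒x≡𝟎 xs (x≥0∧y≥0∧x+y≡0⇒x≡0 (0≤x·x xs) (0≤x*x x) (trans (+-comm _ _) x·x≡0)))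

  sumSqDiff≡[x⊖y]·[x⊖y] : ∀ {n} (x y : Point n) → sumSqDiff x y ≡ (x ⊖ y) · (x ⊖ y)
  sumSqDiff≡[x⊖y]·[x⊖y] []       []       = refl
  sumSqDiff≡[x⊖y]·[x⊖y] (x ∷ xs) (y ∷ ys) = cong ((x - y) * (x - y) +_) (sumSqDiff≡[x⊖y]·[x⊖y] xs ys)

  ⟨⟩-comm : ∀ {n} (x y : Point (suc n)) → ⟨ x , y ⟩ ≡ ⟨ y , x ⟩
  ⟨⟩-comm (x ∷ xs) (y ∷ ys) = cong₂ _-_ (*-comm x y) (·-comm xs ys)

  ⟨⟩-distribʳ-⊖ : ∀ {n} (x y z : Point (suc n)) → ⟨ x ⊖ y , z ⟩ ≡ ⟨ x , z ⟩ - ⟨ y , z ⟩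
  ⟨⟩-distribʳ-⊖ (x ∷ xs) (y ∷ ys) (z ∷ zs) = begin
    ((x - y) * z) - ((xs ⊖ ys) · zs)              ≡⟨ cong (_-_ ((x - y) * z)) (·-distribʳ-⊖ xs ys zs) ⟩
    ((x - y) * z) - ((xs · zs) - (ys · zs))       ≡⟨ solve 5 (λ x y z a b → ((x :- y) :* z) :- (a :- b)
                                                                 := (x :* z :- a) :- (y :* z :- b))
                                                            refl x y z (xs · zs) (ys · zs) ⟩
    ((x * z) - (xs · zs)) - ((y * z) - (ys · zs)) ∎

  ⟨⊙,⟩ : ∀ {n} s (x y : Point (suc n)) → ⟨ s ⊙ x , y ⟩ ≡ s * ⟨ x , y ⟩
  ⟨⊙,⟩ s (x ∷ xs) (y ∷ ys) = begin
    (s * x * y) - ((s ⊙ xs) · ys)   ≡⟨ cong (_-_ (s * x * y)) (⊙-· s xs ys) ⟩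
    (s * x * y) - (s * (xs · ys))   ≡⟨ solve 4 (λ s x y a → (s :* x :* y) :- (s :* a) := s :* (x :* y :- a))
                                              refl s x y (xs · ys) ⟩
    s * ((x * y) - (xs · ys))       ∎

  ⟨𝟎,x⟩≡0 : ∀ {n} (x : Point (suc n)) → ⟨ 𝟎 , x ⟩ ≡ 0#
  ⟨𝟎,x⟩≡0 (x ∷ xs) = trans (cong₂ _-_ (zeroˡ x) (𝟎·x≡0 xs)) (-‿inverseʳ 0#)

  ⟨x⊖a⊙w,z⟩ : ∀ {n} (x w z : Point (suc n)) a → ⟨ x ⊖ a ⊙ w , z ⟩ ≡ ⟨ x , z ⟩ - (a * ⟨ w , z ⟩)
  ⟨x⊖a⊙w,z⟩ x w z a = trans (⟨⟩-distribʳ-⊖ x (a ⊙ w) z) (cong (_-_ ⟨ x , z ⟩) (⟨⊙,⟩ a w z))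

  ‖s⊙x‖² : ∀ {n} s (x : Point (suc n)) → ‖ s ⊙ x ‖² ≡ s * s * ‖ x ‖²
  ‖s⊙x‖² s x = begin
    ⟨ s ⊙ x , s ⊙ x ⟩     ≡⟨ ⟨⊙,⟩ s x (s ⊙ x) ⟩
    s * ⟨ x , s ⊙ x ⟩     ≡⟨ cong (s *_) (trans (⟨⟩-comm x (s ⊙ x)) (⟨⊙,⟩ s x x)) ⟩
    s * (s * ‖ x ‖²)      ≡⟨ sym (*-assoc s s _) ⟩
    s * s * ‖ x ‖²        ∎

  ‖x⊖a⊙w‖² : ∀ {n} (x w : Point (suc n)) a →
             ‖ x ⊖ a ⊙ w ‖² ≡ (‖ x ‖² - (two * a * ⟨ x , w ⟩)) + a * a * ‖ w ‖²
  ‖x⊖a⊙w‖² x w a = begin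
    ⟨ y , y ⟩
      ≡⟨ ⟨x⊖a⊙w,z⟩ x w y a ⟩
    ⟨ x , y ⟩ - (a * ⟨ w , y ⟩)
      ≡⟨ cong₂ (λ s t → s - (a * t)) (⟨⟩-comm x y) (⟨⟩-comm w y) ⟩
    ⟨ y , x ⟩ - (a * ⟨ y , w ⟩)
      ≡⟨ cong₂ (λ s t → s - (a * t)) (⟨x⊖a⊙w,z⟩ x w x a) (⟨x⊖a⊙w,z⟩ x w w a) ⟩
    (‖ x ‖² - (a * ⟨ w , x ⟩)) - (a * (⟨ x , w ⟩ - (a * ‖ w ‖²)))
      ≡⟨ cong (λ t → (‖ x ‖² - (a * t)) - (a * (⟨ x , w ⟩ - (a * ‖ w ‖²)))) (⟨⟩-comm w x) ⟩
    (‖ x ‖² - (a * ⟨ x , w ⟩)) - (a * (⟨ x , w ⟩ - (a * ‖ w ‖²)))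
      ≡⟨ solve 4 (λ q b r a → (q :- a :* b) :- a :* (b :- a :* r) := (q :- con (ℤ.+ 2) :* a :* b) :+ a :* a :* r)
                 refl ‖ x ‖² ⟨ x , w ⟩ ‖ w ‖² a ⟩
    (‖ x ‖² - (two * a * ⟨ x , w ⟩)) + a * a * ‖ w ‖²
      ∎
    where y = x ⊖ a ⊙ w

  timeSq-spaceSq≡‖p⊖q‖² : ∀ {n} (p q : Point (suc n)) → timeSq p q - spaceSq p q ≡ ‖ p ⊖ q ‖²
  timeSq-spaceSq≡‖p⊖q‖² (x ∷ xs) (y ∷ ys) = cong (_-_ ((x - y) * (x - y))) (sumSqDiff≡[x⊖y]·[x⊖y] xs ys)

  spaceSq-timeSq≡-‖p⊖q‖² : ∀ {n} (p q : Point (suc n)) → spaceSq p q - timeSq p q ≡ - ‖ p ⊖ q ‖²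
  spaceSq-timeSq≡-‖p⊖q‖² p q = trans (solve 2 (λ t s → s :- t := :- (t :- s)) refl (timeSq p q) (spaceSq p q))
                                     (cong -_ (timeSq-spaceSq≡‖p⊖q‖² p q))

  module _ {n} (p q : Point (suc n)) where

    τ⇒‖p⊖q‖²>0 : τ-rel p q → 0# < ‖ p ⊖ q ‖²
    τ⇒‖p⊖q‖²>0 pτq = subst (0# <_) (timeSq-spaceSq≡‖p⊖q‖² p q) (x<y⇒0<y-x pτq)

    ‖p⊖q‖²>0⇒τ : 0# < ‖ p ⊖ q ‖² → τ-rel p q
    ‖p⊖q‖²>0⇒τ h = 0<y-x⇒x<y (subst (0# <_) (sym (timeSq-spaceSq≡‖p⊖q‖² p q)) h)

    σ⇒‖p⊖q‖²<0 : σ-rel p q → 0# < (- ‖ p ⊖ q ‖²)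
    σ⇒‖p⊖q‖²<0 pσq = subst (0# <_) (spaceSq-timeSq≡-‖p⊖q‖² p q) (x<y⇒0<y-x pσq)

    ‖p⊖q‖²<0⇒σ : 0# < (- ‖ p ⊖ q ‖²) → σ-rel p q
    ‖p⊖q‖²<0⇒σ h = 0<y-x⇒x<y (subst (0# <_) (sym (spaceSq-timeSq≡-‖p⊖q‖² p q)) h)

    timeSq≡spaceSq⇒‖p⊖q‖²≡0 : timeSq p q ≡ spaceSq p q → ‖ p ⊖ q ‖² ≡ 0#
    timeSq≡spaceSq⇒‖p⊖q‖²≡0 t≡s = trans (sym (timeSq-spaceSq≡‖p⊖q‖² p q)) (x≡y⇒x-y≡0 t≡s)

    ‖p⊖q‖²≡0⇒timeSq≡spaceSq : ‖ p ⊖ q ‖² ≡ 0# → timeSq p q ≡ spaceSq p q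
    ‖p⊖q‖²≡0⇒timeSq≡spaceSq h = x-y≡0⇒x≡y (trans (timeSq-spaceSq≡‖p⊖q‖² p q) h)

  ‖v‖²≡0⇒head≡0⇒v≡𝟎 : ∀ {n} (v : Point (suc n)) → ‖ v ‖² ≡ 0# → head v ≡ 0# → v ≡ 𝟎
  ‖v‖²≡0⇒head≡0⇒v≡𝟎 (t ∷ xs) ‖v‖²≡0 refl =
    cong (0# ∷_) (x·x≡0⇒x≡𝟎 xs (trans (sym (x-y≡0⇒x≡y ‖v‖²≡0)) (zeroˡ 0#)))

  ‖x⊖w‖² : ∀ {n} (x w : Point (suc n)) → ‖ x ⊖ w ‖² ≡ (‖ x ‖² - (two * ⟨ x , w ⟩)) + ‖ w ‖²
  ‖x⊖w‖² x w = begin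
    ‖ x ⊖ w ‖²
      ≡⟨ cong (λ y → ‖ x ⊖ y ‖²) (sym (1⊙x≡x w)) ⟩
    ‖ x ⊖ 1# ⊙ w ‖²
      ≡⟨ ‖x⊖a⊙w‖² x w 1# ⟩
    (‖ x ‖² - (two * 1# * ⟨ x , w ⟩)) + 1# * 1# * ‖ w ‖²
      ≡⟨ solve 3 (λ q b r → (q :- con (ℤ.+ 2) :* con (ℤ.+ 1) :* b) :+ con (ℤ.+ 1) :* con (ℤ.+ 1) :* r
                            := (q :- con (ℤ.+ 2) :* b) :+ r)
                 refl ‖ x ‖² ⟨ x , w ⟩ ‖ w ‖² ⟩
    (‖ x ‖² - (two * ⟨ x , w ⟩)) + ‖ w ‖²
      ∎

  head-⊖ : ∀ {n} (p q : Point (suc n)) → head (p ⊖ q) ≡ head p - head q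
  head-⊖ (x ∷ xs) (y ∷ ys) = refl

  ‖p⊖q‖²≡0⇒head≡⇒p≡q : ∀ {n} (p q : Point (suc n)) → ‖ p ⊖ q ‖² ≡ 0# → head p ≡ head q → p ≡ q
  ‖p⊖q‖²≡0⇒head≡⇒p≡q p q ‖p⊖q‖²≡0 head≡ = x⊖y≡𝟎⇒x≡y p q
    (‖v‖²≡0⇒head≡0⇒v≡𝟎 (p ⊖ q) ‖p⊖q‖²≡0 (trans (head-⊖ p q) (x≡y⇒x-y≡0 head≡)))

  parallelogram : ∀ {n} (x y : Point (suc n)) → ‖ x ⊖ y ‖² + ‖ x ⊖ (- 1#) ⊙ y ‖² ≡ two * (‖ x ‖² + ‖ y ‖²)
  parallelogram x y = begin
    ‖ x ⊖ y ‖² + ‖ x ⊖ (- 1#) ⊙ y ‖²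
      ≡⟨ cong₂ _+_ (‖x⊖w‖² x y) (‖x⊖a⊙w‖² x y (- 1#)) ⟩
    ((‖ x ‖² - (two * ⟨ x , y ⟩)) + ‖ y ‖²) + ((‖ x ‖² - (two * - 1# * ⟨ x , y ⟩)) + - 1# * - 1# * ‖ y ‖²)
      ≡⟨ solve 3 (λ q b r → ((q :- con (ℤ.+ 2) :* b) :+ r)
                            :+ ((q :- con (ℤ.+ 2) :* (:- con (ℤ.+ 1)) :* b) :+ (:- con (ℤ.+ 1)) :* (:- con (ℤ.+ 1)) :* r)
                           := con (ℤ.+ 2) :* (q :+ r))
               refl ‖ x ‖² ⟨ x , y ⟩ ‖ y ‖² ⟩
    two * (‖ x ‖² + ‖ y ‖²) ∎

  module _ {n} (v e : Point (suc n)) (‖v‖²≡0 : ‖ v ‖² ≡ 0#) (‖e‖²≡0 : ‖ e ‖² ≡ 0#) where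

    ‖v⊖e‖²≡0⇒⟨v,e⟩≡0 : ‖ v ⊖ e ‖² ≡ 0# → ⟨ v , e ⟩ ≡ 0#
    ‖v⊖e‖²≡0⇒⟨v,e⟩≡0 ‖v⊖e‖²≡0 = x*y≡0⇒y≡0 (sym (x≡[x-y]+z⇒z≡y (begin
      0#                                     ≡⟨ sym ‖v⊖e‖²≡0 ⟩
      ‖ v ⊖ e ‖²                             ≡⟨ ‖x⊖w‖² v e ⟩
      (‖ v ‖² - (two * ⟨ v , e ⟩)) + ‖ e ‖²
        ≡⟨ cong₂ (λ q r → (q - (two * ⟨ v , e ⟩)) + r) ‖v‖²≡0 ‖e‖²≡0 ⟩
      (0# - (two * ⟨ v , e ⟩)) + 0#          ∎))) 2≢0

    ⟨v,e⟩≡0⇒v≡head[v]⊙e : ⟨ v , e ⟩ ≡ 0# → head e ≡ 1# → v ≡ head v ⊙ e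
    ⟨v,e⟩≡0⇒v≡head[v]⊙e ⟨v,e⟩≡0 head[e]≡1 = ‖p⊖q‖²≡0⇒head≡⇒p≡q v (t ⊙ e) (begin
      ‖ v ⊖ t ⊙ e ‖²
        ≡⟨ ‖x⊖a⊙w‖² v e t ⟩
      (‖ v ‖² - (two * t * ⟨ v , e ⟩)) + t * t * ‖ e ‖²
        ≡⟨ cong₂ (λ b r → (‖ v ‖² - (two * t * b)) + t * t * r) ⟨v,e⟩≡0 ‖e‖²≡0 ⟩
      (‖ v ‖² - (two * t * 0#)) + t * t * 0#
        ≡⟨ cong (λ q → (q - (two * t * 0#)) + t * t * 0#) ‖v‖²≡0 ⟩
      (0# - (two * t * 0#)) + t * t * 0#
        ≡⟨ solve 1 (λ t → (con (ℤ.+ 0) :- con (ℤ.+ 2) :* t :* con (ℤ.+ 0)) :+ t :* t :* con (ℤ.+ 0) := con (ℤ.+ 0))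
                   refl t ⟩
      0#
        ∎) (head-⊙ e head[e]≡1)
      where
      t = head v
      head-⊙ : ∀ (u : Point (suc n)) → head u ≡ 1# → t ≡ head (t ⊙ u)
      head-⊙ (e₀ ∷ _) refl = sym (*-identityʳ t)

module Similarities {c ℓ} (F : OrderedField c ℓ) (_≟_ : DecidableEquality (OrderedField.Carrier F)) (n : ℕ) where

  open OrderedFieldProperties F
  open MinkowskiSpace F _≟_
  open Space F using (Point)
  open Named F using (⟦_⟧ρ)
  open ≡-Reasoning

  𝔼 : Set c
  𝔼 = Point (suc n)

  record Similarity : Set (c ⊔ ℓ) where
    field
      to from : 𝔼 → 𝔼
      to-from : ∀ x → to (from x) ≡ x
      from-to : ∀ x → from (to x) ≡ x
      ratio   : Carrier
      ratio>0 : 0# < ratio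
      scales  : ∀ p q → ‖ to p ⊖ to q ‖² ≡ ratio * ‖ p ⊖ q ‖²

  open Similarity

  to-injective : ∀ (A : Similarity) {p q} → to A p ≡ to A q → p ≡ q
  to-injective A {p} {q} Ap≡Aq = trans (sym (from-to A p)) (trans (cong (from A) Ap≡Aq) (from-to A q))

  _⁻¹ : Similarity → Similarity
  A ⁻¹ = record
    { to = from A ; from = to A ; to-from = from-to A ; from-to = to-from A
    ; ratio = r⁻¹ ; ratio>0 = inv-pos (ratio>0 A) ; scales = scales⁻¹ }
    where
    r⁻¹ = inv (ratio A) (≢-sym (proj₂ (ratio>0 A)))
    scales⁻¹ : ∀ p q → ‖ from A p ⊖ from A q ‖² ≡ r⁻¹ * ‖ p ⊖ q ‖²
    scales⁻¹ p q = begin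
      ‖ p′ ⊖ q′ ‖²                    ≡⟨ sym (*-identityˡ _) ⟩
      1# * ‖ p′ ⊖ q′ ‖²               ≡⟨ cong (_* ‖ p′ ⊖ q′ ‖²) (sym (inv*x≡1 (ratio A) _)) ⟩
      (r⁻¹ * ratio A) * ‖ p′ ⊖ q′ ‖²  ≡⟨ *-assoc _ _ _ ⟩
      r⁻¹ * (ratio A * ‖ p′ ⊖ q′ ‖²)  ≡⟨ cong (r⁻¹ *_) (sym (scales A p′ q′)) ⟩
      r⁻¹ * ‖ to A p′ ⊖ to A q′ ‖²    ≡⟨ cong₂ (λ x y → r⁻¹ * ‖ x ⊖ y ‖²) (to-from A p) (to-from A q) ⟩
      r⁻¹ * ‖ p ⊖ q ‖²                ∎
      where
      p′ = from A p
      q′ = from A q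

  _∘ˢ_ : Similarity → Similarity → Similarity
  A ∘ˢ B = record
    { to = λ x → to A (to B x) ; from = λ x → from B (from A x)
    ; to-from = λ x → trans (cong (to A) (to-from B _)) (to-from A x)
    ; from-to = λ x → trans (cong (from B) (from-to A _)) (from-to B x)
    ; ratio = ratio A * ratio B ; ratio>0 = *-pos (ratio>0 A) (ratio>0 B)
    ; scales = λ p q → trans (scales A _ _) (trans (cong (ratio A *_) (scales B p q)) (sym (*-assoc _ _ _))) }

  infix 4 _∼_
  _∼_ : 𝔼 × 𝔼 → 𝔼 × 𝔼 → Set (c ⊔ ℓ)
  (p , q) ∼ (p′ , q′) = Σ Similarity λ A → to A p ≡ p′ × to A q ≡ q′

  ∼-trans : ∀ {x y z} → x ∼ y → y ∼ z → x ∼ z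
  ∼-trans (A , refl , refl) (B , refl , refl) = B ∘ˢ A , refl , refl

  ‖to‖² : ∀ (A : Similarity) → to A 𝟎 ≡ 𝟎 → ∀ v → ‖ to A v ‖² ≡ ratio A * ‖ v ‖²
  ‖to‖² A to𝟎≡𝟎 v = begin
    ‖ to A v ‖²              ≡⟨ cong ‖_‖² (sym (x⊖𝟎≡x (to A v))) ⟩
    ‖ to A v ⊖ 𝟎 ‖²          ≡⟨ cong (λ o → ‖ to A v ⊖ o ‖²) (sym to𝟎≡𝟎) ⟩
    ‖ to A v ⊖ to A 𝟎 ‖²     ≡⟨ scales A v 𝟎 ⟩
    ratio A * ‖ v ⊖ 𝟎 ‖²     ≡⟨ cong (λ x → ratio A * ‖ x ‖²) (x⊖𝟎≡x v) ⟩
    ratio A * ‖ v ‖²         ∎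

  preserves : ∀ (A : Similarity) ρ {p q : 𝔼} → ⟦ ρ ⟧ρ p q → ⟦ ρ ⟧ρ (to A p) (to A q)
  preserves A τ {p} {q} (lift pτq) = lift (‖p⊖q‖²>0⇒τ (to A p) (to A q)
    (subst (0# <_) (sym (scales A p q)) (*-pos (ratio>0 A) (τ⇒‖p⊖q‖²>0 p q pτq))))
  preserves A σ {p} {q} (lift pσq) = lift (‖p⊖q‖²<0⇒σ (to A p) (to A q)
    (subst (0# <_) r*-Q≡-Q′ (*-pos (ratio>0 A) (σ⇒‖p⊖q‖²<0 p q pσq))))
    where
    r*-Q≡-Q′ : ratio A * - ‖ p ⊖ q ‖² ≡ - ‖ to A p ⊖ to A q ‖²
    r*-Q≡-Q′ = trans (solve 2 (λ r x → r :* (:- x) := :- (r :* x)) refl (ratio A) ‖ p ⊖ q ‖²)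
                     (cong -_ (sym (scales A p q)))
  preserves A λ' {p} {q} (lift (t≡s , head≢)) = lift
    ( ‖p⊖q‖²≡0⇒timeSq≡spaceSq (to A p) (to A q) ‖Ap⊖Aq‖²≡0
    , λ head≡ → head≢ (cong head (to-injective A (‖p⊖q‖²≡0⇒head≡⇒p≡q _ _ ‖Ap⊖Aq‖²≡0 head≡))) )
    where
    ‖Ap⊖Aq‖²≡0 : ‖ to A p ⊖ to A q ‖² ≡ 0#
    ‖Ap⊖Aq‖²≡0 = trans (scales A p q) (trans (cong (ratio A *_) (timeSq≡spaceSq⇒‖p⊖q‖²≡0 p q t≡s)) (zeroʳ _))

  automorphism : Similarity → ∀ ρ → Automorphism (⟦_⟧ρ {n} ρ)
  automorphism A ρ = record
    { to = to A ; from = from A ; to-from = to-from A ; from-to = from-to A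
    ; preserves = preserves A ρ
    ; reflects = λ {x} {y} r → subst₂ ⟦ ρ ⟧ρ (from-to A x) (from-to A y) (preserves (A ⁻¹) ρ r) }

  translation : 𝔼 → Similarity
  translation a = record
    { to = _⊖ a ; from = _⊕ a ; to-from = λ x → [x⊕y]⊖y≡x x a ; from-to = λ x → [x⊖y]⊕y≡x x a
    ; ratio = 1# ; ratio>0 = 0<1
    ; scales = λ p q → trans (cong ‖_‖² ([x⊖z]⊖[y⊖z]≡x⊖y p q a)) (sym (*-identityˡ _)) }

  dilation : ∀ s → s ≢ 0# → Similarity
  dilation s s≢0 = record
    { to = s ⊙_ ; from = s⁻¹ ⊙_
    ; to-from = λ x → trans (s⊙[t⊙x]≡[s*t]⊙x s s⁻¹ x) (trans (cong (_⊙ x) (x*inv≡1 s s≢0)) (1⊙x≡x x))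
    ; from-to = λ x → trans (s⊙[t⊙x]≡[s*t]⊙x s⁻¹ s x) (trans (cong (_⊙ x) (inv*x≡1 s s≢0)) (1⊙x≡x x))
    ; ratio = s * s ; ratio>0 = 0≤x*x s , ≢-sym (*-≢0 s≢0 s≢0)
    ; scales = λ p q → trans (cong ‖_‖² (s⊙x⊖s⊙y≡s⊙[x⊖y] s p q)) (‖s⊙x‖² s (p ⊖ q)) }
    where s⁻¹ = inv s s≢0

  module Reflection (w : 𝔼) (‖w‖²≢0 : ‖ w ‖² ≢ 0#) where

    private
      i = inv ‖ w ‖² ‖w‖²≢0

    coeff : 𝔼 → Carrier
    coeff y = two * ⟨ y , w ⟩ * i

    reflect : 𝔼 → 𝔼
    reflect y = y ⊖ coeff y ⊙ w

    coeff-⊖ : ∀ p q → coeff p - coeff q ≡ coeff (p ⊖ q)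
    coeff-⊖ p q = begin
      (two * ⟨ p , w ⟩ * i) - (two * ⟨ q , w ⟩ * i)
        ≡⟨ solve 3 (λ a b i → (con (ℤ.+ 2) :* a :* i) :- (con (ℤ.+ 2) :* b :* i) := con (ℤ.+ 2) :* (a :- b) :* i)
                   refl ⟨ p , w ⟩ ⟨ q , w ⟩ i ⟩
      two * (⟨ p , w ⟩ - ⟨ q , w ⟩) * i
        ≡⟨ cong (λ t → two * t * i) (sym (⟨⟩-distribʳ-⊖ p q w)) ⟩
      two * ⟨ p ⊖ q , w ⟩ * i
        ∎

    reflect-scales : ∀ p q → ‖ reflect p ⊖ reflect q ‖² ≡ 1# * ‖ p ⊖ q ‖²
    reflect-scales p q = begin
      ‖ reflect p ⊖ reflect q ‖²
        ≡⟨ cong ‖_‖² ([x⊖a⊙w]⊖[y⊖b⊙w]≡[x⊖y]⊖[a-b]⊙w p q w (coeff p) (coeff q)) ⟩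
      ‖ d ⊖ (coeff p - coeff q) ⊙ w ‖²
        ≡⟨ cong (λ a → ‖ d ⊖ a ⊙ w ‖²) (coeff-⊖ p q) ⟩
      ‖ d ⊖ coeff d ⊙ w ‖²
        ≡⟨ ‖x⊖a⊙w‖² d w (coeff d) ⟩
      (‖ d ‖² - (two * coeff d * ⟨ d , w ⟩)) + coeff d * coeff d * ‖ w ‖²
        ≡⟨ solve 4 (λ q b r i → (q :- con (ℤ.+ 2) :* (con (ℤ.+ 2) :* b :* i) :* b)
                                 :+ (con (ℤ.+ 2) :* b :* i) :* (con (ℤ.+ 2) :* b :* i) :* r
                                := q :+ (con (ℤ.+ 4) :* b :* b :* i) :* (i :* r :- con (ℤ.+ 1)))
                   refl ‖ d ‖² ⟨ d , w ⟩ ‖ w ‖² i ⟩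
      ‖ d ‖² + (four * ⟨ d , w ⟩ * ⟨ d , w ⟩ * i) * ((i * ‖ w ‖²) - 1#)
        ≡⟨ x+y*[z-1]≡x _ _ (inv*x≡1 ‖ w ‖² ‖w‖²≢0) ⟩
      ‖ d ‖²
        ≡⟨ sym (*-identityˡ _) ⟩
      1# * ‖ d ‖²
        ∎
      where
      d = p ⊖ q
      four = ⟦ ℤ.+ 4 ⟧ℤ

    reflect-involutive : ∀ y → reflect (reflect y) ≡ y
    reflect-involutive y = begin
      (y ⊖ k ⊙ w) ⊖ coeff (y ⊖ k ⊙ w) ⊙ w   ≡⟨ cong (λ a → (y ⊖ k ⊙ w) ⊖ a ⊙ w) coeff-reflect ⟩
      (y ⊖ k ⊙ w) ⊖ (- k) ⊙ w               ≡⟨ [x⊖a⊙w]⊖b⊙w≡x⊖[a+b]⊙w y w k (- k) ⟩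
      y ⊖ (k + - k) ⊙ w                     ≡⟨ cong (λ a → y ⊖ a ⊙ w) (-‿inverseʳ k) ⟩
      y ⊖ 0# ⊙ w                            ≡⟨ cong (y ⊖_) (0⊙x≡𝟎 w) ⟩
      y ⊖ 𝟎                                 ≡⟨ x⊖𝟎≡x y ⟩
      y                                     ∎
      where
      k = coeff y
      coeff-reflect : coeff (y ⊖ k ⊙ w) ≡ - k
      coeff-reflect = begin
        two * ⟨ y ⊖ k ⊙ w , w ⟩ * i
          ≡⟨ cong (λ t → two * t * i) (⟨x⊖a⊙w,z⟩ y w w k) ⟩
        two * (⟨ y , w ⟩ - (k * ‖ w ‖²)) * i
          ≡⟨ solve 3 (λ b r i → con (ℤ.+ 2) :* (b :- (con (ℤ.+ 2) :* b :* i) :* r) :* i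
                                := :- (con (ℤ.+ 2) :* b :* i)
                                   :+ (:- (con (ℤ.+ 2) :* (con (ℤ.+ 2) :* b :* i))) :* (i :* r :- con (ℤ.+ 1)))
                     refl ⟨ y , w ⟩ ‖ w ‖² i ⟩
        - k + (- (two * k)) * ((i * ‖ w ‖²) - 1#)
          ≡⟨ x+y*[z-1]≡x _ _ (inv*x≡1 ‖ w ‖² ‖w‖²≢0) ⟩
        - k
          ∎

    reflect-𝟎 : reflect 𝟎 ≡ 𝟎
    reflect-𝟎 = begin
      𝟎 ⊖ (two * ⟨ 𝟎 , w ⟩ * i) ⊙ w ≡⟨ cong (λ t → 𝟎 ⊖ (two * t * i) ⊙ w) (⟨𝟎,x⟩≡0 w) ⟩
      𝟎 ⊖ (two * 0# * i) ⊙ w        ≡⟨ cong (λ a → 𝟎 ⊖ a ⊙ w) (trans (cong (_* i) (zeroʳ two)) (zeroˡ i)) ⟩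
      𝟎 ⊖ 0# ⊙ w                    ≡⟨ cong (𝟎 ⊖_) (0⊙x≡𝟎 w) ⟩
      𝟎 ⊖ 𝟎                         ≡⟨ x⊖x≡𝟎 𝟎 ⟩
      𝟎                             ∎

    reflection : Similarity
    reflection = record
      { to = reflect ; from = reflect ; to-from = reflect-involutive ; from-to = reflect-involutive
      ; ratio = 1# ; ratio>0 = 0<1 ; scales = reflect-scales }

  reflection-maps : ∀ v u → ‖ v ‖² ≡ ‖ u ‖² → (h : ‖ v ⊖ u ‖² ≢ 0#) → Reflection.reflect (v ⊖ u) h v ≡ u
  reflection-maps v u ‖v‖²≡‖u‖² h = begin
    v ⊖ coeff v ⊙ w   ≡⟨ cong (λ a → v ⊖ a ⊙ w) coeff[v]≡1 ⟩
    v ⊖ 1# ⊙ w        ≡⟨ cong (v ⊖_) (1⊙x≡x w) ⟩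
    v ⊖ (v ⊖ u)       ≡⟨ x⊖[x⊖y]≡y v u ⟩
    u                 ∎
    where
    w = v ⊖ u
    open Reflection w h
    ‖u‖²-expansion : ‖ u ‖² ≡ (‖ v ‖² - (two * ⟨ v , w ⟩)) + ‖ w ‖²
    ‖u‖²-expansion = trans (cong ‖_‖² (sym (x⊖[x⊖y]≡y v u))) (‖x⊖w‖² v w)
    ‖w‖²≡2⟨v,w⟩ : ‖ w ‖² ≡ two * ⟨ v , w ⟩
    ‖w‖²≡2⟨v,w⟩ = x≡[x-y]+z⇒z≡y (trans ‖v‖²≡‖u‖² ‖u‖²-expansion)
    coeff[v]≡1 : coeff v ≡ 1#
    coeff[v]≡1 = trans (cong (_* inv ‖ w ‖² h) (sym ‖w‖²≡2⟨v,w⟩)) (x*inv≡1 ‖ w ‖² h)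

  ∼-by-reflection : ∀ v u → ‖ v ‖² ≡ ‖ u ‖² → ‖ v ⊖ u ‖² ≢ 0# → (v , 𝟎) ∼ (u , 𝟎)
  ∼-by-reflection v u ‖v‖²≡‖u‖² h =
    Reflection.reflection (v ⊖ u) h , reflection-maps v u ‖v‖²≡‖u‖² h , Reflection.reflect-𝟎 (v ⊖ u) h

  -- If v − u is null, reflect v to −u instead: by the parallelogram law v − u and v + u are not
  -- both null.
  ∼-same-norm : ∀ v u → ‖ v ‖² ≡ ‖ u ‖² → ‖ v ‖² ≢ 0# → (v , 𝟎) ∼ (u , 𝟎)
  ∼-same-norm v u ‖v‖²≡‖u‖² ‖v‖²≢0 with ‖ v ⊖ u ‖² ≟ 0#
  ... | no  ‖v⊖u‖²≢0 = ∼-by-reflection v u ‖v‖²≡‖u‖² ‖v⊖u‖²≢0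
  ... | yes ‖v⊖u‖²≡0 = ∼-trans (∼-by-reflection v (- 1# ⊙ u) ‖v‖²≡‖-u‖² ‖v⊕u‖²≢0)
                               (dilation (- 1#) -1≢0 , -1⊙[-1⊙u]≡u , s⊙𝟎≡𝟎 (- 1#))
    where
    ‖v‖²≡‖-u‖² : ‖ v ‖² ≡ ‖ - 1# ⊙ u ‖²
    ‖v‖²≡‖-u‖² = trans ‖v‖²≡‖u‖² (sym (trans (‖s⊙x‖² (- 1#) u)
                   (solve 1 (λ r → (:- con (ℤ.+ 1)) :* (:- con (ℤ.+ 1)) :* r := r) refl ‖ u ‖²)))
    -1⊙[-1⊙u]≡u : - 1# ⊙ (- 1# ⊙ u) ≡ u
    -1⊙[-1⊙u]≡u = trans (s⊙[t⊙x]≡[s*t]⊙x (- 1#) (- 1#) u)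
                  (trans (cong (_⊙ u) (solve 0 ((:- con (ℤ.+ 1)) :* (:- con (ℤ.+ 1)) := con (ℤ.+ 1)) refl)) (1⊙x≡x u))
    ‖v⊕u‖²≢0 : ‖ v ⊖ - 1# ⊙ u ‖² ≢ 0#
    ‖v⊕u‖²≢0 ‖v⊕u‖²≡0 = ‖v‖²≢0 (x*y≡0⇒y≡0 (x*y≡0⇒y≡0 4‖v‖²≡0 2≢0) 2≢0)
      where
      4‖v‖²≡0 : two * (two * ‖ v ‖²) ≡ 0#
      4‖v‖²≡0 = begin
        two * (two * ‖ v ‖²)               ≡⟨ solve 1 (λ q → con (ℤ.+ 2) :* (con (ℤ.+ 2) :* q) := con (ℤ.+ 2) :* (q :+ q))
                                                       refl ‖ v ‖² ⟩
        two * (‖ v ‖² + ‖ v ‖²)            ≡⟨ cong (λ r → two * (‖ v ‖² + r)) ‖v‖²≡‖u‖² ⟩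
        two * (‖ v ‖² + ‖ u ‖²)            ≡⟨ sym (parallelogram v u) ⟩
        ‖ v ⊖ u ‖² + ‖ v ⊖ - 1# ⊙ u ‖²     ≡⟨ cong₂ _+_ ‖v⊖u‖²≡0 ‖v⊕u‖²≡0 ⟩
        0# + 0#                            ≡⟨ +-identityˡ 0# ⟩
        0#                                 ∎

  AllRatiosRealised : Set (c ⊔ ℓ)
  AllRatiosRealised = ∀ k → 0# < k → Σ Similarity λ A → to A 𝟎 ≡ 𝟎 × ratio A ≡ k

  ∼-rescale : AllRatiosRealised → ∀ {k} v e → 0# < k → k * ‖ v ‖² ≡ ‖ e ‖² → ‖ e ‖² ≢ 0# → (v , 𝟎) ∼ (e , 𝟎)
  ∼-rescale realise {k} v e 0<k k‖v‖²≡‖e‖² ‖e‖²≢0 with realise k 0<k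
  ... | A , A𝟎≡𝟎 , refl = ∼-trans (A , refl , A𝟎≡𝟎)
                                  (∼-same-norm (to A v) e ‖Av‖²≡‖e‖² ‖Av‖²≢0)
    where
    ‖Av‖²≡‖e‖² : ‖ to A v ‖² ≡ ‖ e ‖²
    ‖Av‖²≡‖e‖² = trans (‖to‖² A A𝟎≡𝟎 v) k‖v‖²≡‖e‖²
    ‖Av‖²≢0 : ‖ to A v ‖² ≢ 0#
    ‖Av‖²≢0 ‖Av‖²≡0 = ‖e‖²≢0 (trans (sym ‖Av‖²≡‖e‖²) ‖Av‖²≡0)

module Classification {c ℓ} (F : OrderedField c ℓ) (_≟_ : DecidableEquality (OrderedField.Carrier F)) (m : ℕ) where

  open OrderedFieldProperties F
  open MinkowskiSpace F _≟_
  open Similarities F _≟_ (suc m)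
  open Space F using (timeSq; spaceSq)
  open Named F
  open ≡-Reasoning

  e-τ e-σ e-λ : 𝔼
  e-τ = 1# ∷ 𝟎
  e-σ = 0# ∷ 1# ∷ 𝟎
  e-λ = 1# ∷ 1# ∷ 𝟎

  canonical : BasicName → 𝔼
  canonical τb  = e-τ
  canonical σb  = e-σ
  canonical λb  = e-λ
  canonical eqb = 𝟎

  ‖e-τ‖²≡1 : ‖ e-τ ‖² ≡ 1#
  ‖e-τ‖²≡1 = trans (cong (_-_ (1# * 1#)) (𝟎·x≡0 (𝟎 {suc m})))
                   (solve 0 ((con (ℤ.+ 1) :* con (ℤ.+ 1)) :- con (ℤ.+ 0) := con (ℤ.+ 1)) refl)

  ‖e-σ‖²≡-1 : ‖ e-σ ‖² ≡ - 1#
  ‖e-σ‖²≡-1 = trans (cong (λ t → (0# * 0#) - (1# * 1# + t)) (𝟎·x≡0 (𝟎 {m})))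
                    (solve 0 ((con (ℤ.+ 0) :* con (ℤ.+ 0)) :- (con (ℤ.+ 1) :* con (ℤ.+ 1) :+ con (ℤ.+ 0))
                              := :- con (ℤ.+ 1)) refl)

  ‖e-λ‖²≡0 : ‖ e-λ ‖² ≡ 0#
  ‖e-λ‖²≡0 = trans (cong (λ t → (1# * 1#) - (1# * 1# + t)) (𝟎·x≡0 (𝟎 {m})))
                   (solve 0 ((con (ℤ.+ 1) :* con (ℤ.+ 1)) :- (con (ℤ.+ 1) :* con (ℤ.+ 1) :+ con (ℤ.+ 0))
                             := con (ℤ.+ 0)) refl)

  ∼-e-τ : AllRatiosRealised → ∀ v → 0# < ‖ v ‖² → (v , 𝟎) ∼ (e-τ , 𝟎)
  ∼-e-τ realise v 0<‖v‖² = ∼-rescale realise v e-τ (inv-pos 0<‖v‖²)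
    (trans (inv*x≡1 ‖ v ‖² _) (sym ‖e-τ‖²≡1)) (λ ‖e-τ‖²≡0 → 0≢1 (trans (sym ‖e-τ‖²≡0) ‖e-τ‖²≡1))

  ∼-e-σ : AllRatiosRealised → ∀ v → 0# < (- ‖ v ‖²) → (v , 𝟎) ∼ (e-σ , 𝟎)
  ∼-e-σ realise v 0<-‖v‖² = ∼-rescale realise v e-σ (inv-pos 0<-‖v‖²) k‖v‖²≡‖e-σ‖²
    (λ ‖e-σ‖²≡0 → -1≢0 (trans (sym ‖e-σ‖²≡-1) ‖e-σ‖²≡0))
    where
    k = inv (- ‖ v ‖²) (≢-sym (proj₂ 0<-‖v‖²))
    k‖v‖²≡‖e-σ‖² : k * ‖ v ‖² ≡ ‖ e-σ ‖²
    k‖v‖²≡‖e-σ‖² = begin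
      k * ‖ v ‖²        ≡⟨ solve 2 (λ k q → k :* q := :- (k :* (:- q))) refl k ‖ v ‖² ⟩
      - (k * - ‖ v ‖²)  ≡⟨ cong -_ (inv*x≡1 (- ‖ v ‖²) _) ⟩
      - 1#              ≡⟨ sym ‖e-σ‖²≡-1 ⟩
      ‖ e-σ ‖²          ∎

  -- If v − e-λ is null, then v is orthogonal to e-λ and therefore a multiple of it.
  ∼-e-λ : ∀ v → ‖ v ‖² ≡ 0# → head v ≢ 0# → (v , 𝟎) ∼ (e-λ , 𝟎)
  ∼-e-λ v ‖v‖²≡0 t≢0 with ‖ v ⊖ e-λ ‖² ≟ 0#
  ... | no  ‖v⊖e‖²≢0 = ∼-by-reflection v e-λ (trans ‖v‖²≡0 (sym ‖e-λ‖²≡0)) ‖v⊖e‖²≢0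
  ... | yes ‖v⊖e‖²≡0 = dilation t⁻¹ (inv-≢0 t t≢0) , t⁻¹⊙v≡e-λ , s⊙𝟎≡𝟎 t⁻¹
    where
    t   = head v
    t⁻¹ = inv t t≢0
    v≡t⊙e-λ : v ≡ t ⊙ e-λ
    v≡t⊙e-λ = ⟨v,e⟩≡0⇒v≡head[v]⊙e v e-λ ‖v‖²≡0 ‖e-λ‖²≡0
                (‖v⊖e‖²≡0⇒⟨v,e⟩≡0 v e-λ ‖v‖²≡0 ‖e-λ‖²≡0 ‖v⊖e‖²≡0) refl
    t⁻¹⊙v≡e-λ : t⁻¹ ⊙ v ≡ e-λ
    t⁻¹⊙v≡e-λ = begin
      t⁻¹ ⊙ v           ≡⟨ cong (t⁻¹ ⊙_) v≡t⊙e-λ ⟩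
      t⁻¹ ⊙ (t ⊙ e-λ)   ≡⟨ s⊙[t⊙x]≡[s*t]⊙x t⁻¹ t e-λ ⟩
      (t⁻¹ * t) ⊙ e-λ   ≡⟨ cong (_⊙ e-λ) (inv*x≡1 t t≢0) ⟩
      1# ⊙ e-λ          ≡⟨ 1⊙x≡x e-λ ⟩
      e-λ               ∎

  classify : ∀ (p q : 𝔼) → ∃[ b ] ⟦ b ⟧b p q
  classify p q with timeSq p q ≟ spaceSq p q
  ... | yes t≡s with head p ≟ head q
  ...   | yes head≡ = eqb , lift (‖p⊖q‖²≡0⇒head≡⇒p≡q p q (timeSq≡spaceSq⇒‖p⊖q‖²≡0 p q t≡s) head≡)
  ...   | no  head≢ = λb , lift (t≡s , head≢)
  classify p q | no t≢s with ≤-total (spaceSq p q) (timeSq p q)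
  ... | inj₁ s≤t = τb , lift (s≤t , ≢-sym t≢s)
  ... | inj₂ t≤s = σb , lift (t≤s , t≢s)

  ∼-canonical : AllRatiosRealised → ∀ b (p q : 𝔼) → ⟦ b ⟧b p q → (p , q) ∼ (canonical b , 𝟎)
  ∼-canonical realise eqb p .p (lift refl) = translation p , x⊖x≡𝟎 p , x⊖x≡𝟎 p
  ∼-canonical realise τb  p q (lift pτq) = ∼-trans (translation q , refl , x⊖x≡𝟎 q)
    (∼-e-τ realise (p ⊖ q) (τ⇒‖p⊖q‖²>0 p q pτq))
  ∼-canonical realise σb  p q (lift pσq) = ∼-trans (translation q , refl , x⊖x≡𝟎 q)
    (∼-e-σ realise (p ⊖ q) (σ⇒‖p⊖q‖²<0 p q pσq))
  ∼-canonical realise λb  p q (lift (t≡s , head≢)) = ∼-trans (translation q , refl , x⊖x≡𝟎 q)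
    (∼-e-λ (p ⊖ q) (timeSq≡spaceSq⇒‖p⊖q‖²≡0 p q t≡s)
           (λ head≡0 → head≢ (x-y≡0⇒x≡y (trans (sym (head-⊖ p q)) head≡0))))

  definable⇒union-of-basic : AllRatiosRealised → ∀ ρ {r} (S : Rel 𝔼 r) → Decidable S →
                             Definable (⟦_⟧ρ ρ) S → ∃[ sel ] IsUnionOf sel S
  definable⇒union-of-basic realise ρ S S? definable = sel , λ p q → mk⇔ (into p q) (outof p q)
    where
    sel : BasicName → Bool
    sel b = isYes (S? (canonical b) 𝟎)

    S⇔S-canonical : ∀ b p q → ⟦ b ⟧b p q → S p q ⇔ S (canonical b) 𝟎
    S⇔S-canonical b p q pbq with ∼-canonical realise b p q pbq
    ... | A , Ap≡ , Aq≡ = subst₂ (λ x y → S p q ⇔ S x y) Ap≡ Aq≡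
                                 (definable-invariant (⟦_⟧ρ ρ) (automorphism A ρ) definable p q)

    into : ∀ p q → S p q → ∃[ b ] (sel b ≡ true × ⟦ b ⟧b p q)
    into p q s with classify p q
    ... | b , pbq = b , Equivalence.to T-≡ (fromWitness (Equivalence.to (S⇔S-canonical b p q pbq) s)) , pbq

    outof : ∀ p q → ∃[ b ] (sel b ≡ true × ⟦ b ⟧b p q) → S p q
    outof p q (b , sel[b]≡true , pbq) =
      Equivalence.from (S⇔S-canonical b p q pbq) (toWitness (Equivalence.from T-≡ sel[b]≡true))

module RatioRealisation {c ℓ} (F : OrderedField c ℓ) (_≟_ : DecidableEquality (OrderedField.Carrier F)) where

  open OrderedFieldProperties F
  open MinkowskiSpace F _≟_
  open ≡-Reasoning

  euclidean⇒all-ratios : IsEuclidean F → ∀ n → Similarities.AllRatiosRealised F _≟_ n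
  euclidean⇒all-ratios sqrt n k 0<k with sqrt k (proj₁ 0<k)
  ... | s , s*s≡k = dilation s s≢0 , s⊙𝟎≡𝟎 s , s*s≡k
    where
    open Similarities F _≟_ n
    s≢0 : s ≢ 0#
    s≢0 s≡0 = proj₂ 0<k (trans (sym (zeroˡ 0#)) (subst (λ x → x * x ≡ k) s≡0 s*s≡k))

  boost-map : Carrier → Carrier → Space.Point F 2 → Space.Point F 2
  boost-map a b (t ∷ x ∷ []) = (a * t + b * x) ∷ (b * t + a * x) ∷ []

  boost-map-∘ : ∀ a b c d y → boost-map a b (boost-map c d y) ≡ boost-map (a * c + b * d) (a * d + b * c) y
  boost-map-∘ a b c d (t ∷ x ∷ []) = cong₂ _∷_
    (solve 6 (λ a b c d t x → a :* (c :* t :+ d :* x) :+ b :* (d :* t :+ c :* x)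
                             := (a :* c :+ b :* d) :* t :+ (a :* d :+ b :* c) :* x) refl a b c d t x)
    (cong₂ _∷_
      (solve 6 (λ a b c d t x → b :* (c :* t :+ d :* x) :+ a :* (d :* t :+ c :* x)
                               := (a :* d :+ b :* c) :* t :+ (a :* c :+ b :* d) :* x) refl a b c d t x)
      refl)

  boost-map-id : ∀ y → boost-map 1# 0# y ≡ y
  boost-map-id (t ∷ x ∷ []) = cong₂ _∷_
    (solve 2 (λ t x → con (ℤ.+ 1) :* t :+ con (ℤ.+ 0) :* x := t) refl t x)
    (cong₂ _∷_ (solve 2 (λ t x → con (ℤ.+ 0) :* t :+ con (ℤ.+ 1) :* x := x) refl t x) refl)

  module _ (a b : Carrier) (0<k : 0# < ((a * a) - (b * b))) where
    open Similarities F _≟_ 1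

    private
      k = (a * a) - (b * b)
      k⁻¹ = inv k (≢-sym (proj₂ 0<k))
      a′ = a * k⁻¹
      b′ = - (b * k⁻¹)

      boost-map-inverse : ∀ {c d c′ d′} → c * c′ + d * d′ ≡ 1# → c * d′ + d * c′ ≡ 0# →
                          ∀ y → boost-map c d (boost-map c′ d′ y) ≡ y
      boost-map-inverse {c} {d} {c′} {d′} e₁ e₀ y =
        trans (boost-map-∘ c d c′ d′ y) (trans (cong₂ (λ u v → boost-map u v y) e₁ e₀) (boost-map-id y))

    boost : Similarity
    boost = record
      { to = boost-map a b ; from = boost-map a′ b′
      ; to-from = boost-map-inverse
          (trans (solve 3 (λ a b i → a :* (a :* i) :+ b :* (:- (b :* i)) := ((a :* a) :- (b :* b)) :* i) refl a b k⁻¹)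
                 (x*inv≡1 k _))
          (solve 3 (λ a b i → a :* (:- (b :* i)) :+ b :* (a :* i) := con (ℤ.+ 0)) refl a b k⁻¹)
      ; from-to = boost-map-inverse
          (trans (solve 3 (λ a b i → a :* i :* a :+ (:- (b :* i)) :* b := ((a :* a) :- (b :* b)) :* i) refl a b k⁻¹)
                 (x*inv≡1 k _))
          (solve 3 (λ a b i → a :* i :* b :+ (:- (b :* i)) :* a := con (ℤ.+ 0)) refl a b k⁻¹)
      ; ratio = k ; ratio>0 = 0<k ; scales = scales }
      where
      scales : ∀ p q → ‖ boost-map a b p ⊖ boost-map a b q ‖² ≡ k * ‖ p ⊖ q ‖²
      scales (p₀ ∷ p₁ ∷ []) (q₀ ∷ q₁ ∷ []) = solve 6 (λ a b p₀ p₁ q₀ q₁ →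
          let t = (a :* p₀ :+ b :* p₁) :- (a :* q₀ :+ b :* q₁)
              x = (b :* p₀ :+ a :* p₁) :- (b :* q₀ :+ a :* q₁)
          in  t :* t :- (x :* x :+ con (ℤ.+ 0))
              := ((a :* a) :- (b :* b)) :* (((p₀ :- q₀) :* (p₀ :- q₀)) :- ((p₁ :- q₁) :* (p₁ :- q₁) :+ con (ℤ.+ 0))))
        refl a b p₀ p₁ q₀ q₁

    boost-𝟎 : boost-map a b 𝟎 ≡ 𝟎
    boost-𝟎 = cong₂ _∷_ (solve 2 (λ a b → a :* con (ℤ.+ 0) :+ b :* con (ℤ.+ 0) := con (ℤ.+ 0)) refl a b)
                (cong₂ _∷_ (solve 2 (λ a b → b :* con (ℤ.+ 0) :+ a :* con (ℤ.+ 0) := con (ℤ.+ 0)) refl a b) refl)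

  planar-all-ratios : Similarities.AllRatiosRealised F _≟_ 1
  planar-all-ratios d 0<d = boost a b 0<a²-b² , boost-𝟎 a b 0<a²-b² , a²-b²≡d
    where
    h = inv two 2≢0
    a = h * (d + 1#)
    b = h * (d - 1#)
    a²-b²≡d : (a * a) - (b * b) ≡ d
    a²-b²≡d = trans (solve 2 (λ h d → ((h :* (d :+ con (ℤ.+ 1))) :* (h :* (d :+ con (ℤ.+ 1))))
                                      :- ((h :* (d :- con (ℤ.+ 1))) :* (h :* (d :- con (ℤ.+ 1))))
                                    := d :+ d :* ((con (ℤ.+ 2) :* h) :* (con (ℤ.+ 2) :* h) :- con (ℤ.+ 1))) refl h d)
                    (x+y*[z-1]≡x _ _ (trans (cong₂ _*_ (x*inv≡1 two 2≢0) (x*inv≡1 two 2≢0)) (*-identityˡ 1#)))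
    0<a²-b² : 0# < ((a * a) - (b * b))
    0<a²-b² = subst (0# <_) (sym a²-b²≡d) 0<d

  all-ratios : ∀ m → suc (suc m) ≡ 2 ⊎ IsEuclidean F → Similarities.AllRatiosRealised F _≟_ (suc m)
  all-ratios _ (inj₁ refl)      = planar-all-ratios
  all-ratios m (inj₂ euclidean) = euclidean⇒all-ratios euclidean (suc m)

open import Data.Nat using (_≤_; s≤s)

corollary2p4 : ∀ {c ℓ r} → ExcludedMiddle (c ⊔ ℓ ⊔ r) →
    (F : OrderedField c ℓ) (m : ℕ) → 2 ≤ suc m →
    (suc m ≡ 2 ⊎ IsEuclidean F) →
    (ρ : RhoName) (S : Rel (Space.Point F (suc m)) r) →
    Definable (Named.⟦_⟧ρ F ρ) S →
    (∃[ p ] ∃[ q ] S p q) →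
    ∃[ sel ] Named.IsUnionOf F {m} sel S
corollary2p4 em F zero (s≤s ()) _ _ _ _ _
corollary2p4 {c} {ℓ} {r} em F (suc m) _ n≡2⊎euclidean ρ S definable _ =
  Classification.definable⇒union-of-basic F _≟_ m
    (RatioRealisation.all-ratios F _≟_ m n≡2⊎euclidean) ρ S S? definable
  where
  _≟_ : DecidableEquality (OrderedField.Carrier F)
  x ≟ y = Dec.map′ lower lift (em {Lift (ℓ ⊔ r) (x ≡ y)})
  S? : Decidable S
  S? p q = Dec.map′ lower lift (em {Lift (c ⊔ ℓ) (S p q)})
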